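{- Let $D=(X,Y,A)$ be an oriented split graph in which $D[Y]$ is a regular tournament. Write $d^+(v)=|N^+(v)|$ and $d^-(v)=|N^-(v)|$ (in $D$). Then: (A1) for every $x\in X$, $d^{++}_Y(x)\ge d^+(x)$ or $d^{++}_Y(x)\ge d^-(x)$ (or both); (A2) for every $x\in X$, $d^{ -- }_Y(x)\ge d^-(x)$ or $d^{ -- }_Y(x)\ge d^+(x)$ (or both); (B1) either there exists $x'\in X$ with $d^{++}_Y(x')\ge d^+(x')$, or $d^{ -- }_Y(x)\ge d^-(x)$ for all $x\in X$; (B2) either there exists $x'\in X$ with $d^{++}_Y(x')\ge d^-(x')$, or $d^{ -- }_Y(x)\ge d^+(x)$ for all $x\in X$; (C1) there exists $v\in V(D)$ with $d^{++}(v)\ge d^+(v)$; (C2) there exists $v\in V(D)$ with $d^{++}(v)\ge d^-(v)$.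
   Context: An oriented split graph $D=(X,Y,A)$ is an oriented graph (loopless, no pair of opposite arcs) whose vertex set is partitioned into $X$ and $Y$ with $X$ independent and $D[Y]$ a tournament. A tournament is regular if every vertex has equal in- and out-degree. For a vertex $u$ of $D$: $N^+(u)=\{v:uv\in A\}$, $N^-(u)=\{v:vu\in A\}$, $N^{++}(u)=\{v: uw,wv\in A \text{ for some } w\}\setminus N^+(u)$, $N^{ -- }(u)=\{v: vw,wu\in A\text{ for some } w\}\setminus N^-(u)$; $d^{++}(u)=|N^{++}(u)|$, $d^{++}_Y(u)=|N^{++}(u)\cap Y|$, $d^{ -- }_Y(u)=|N^{ -- }(u)\cap Y|$. -}

module Defs where

open import Data.Nat using (ℕ; zero; suc; _+_; _≥_)
open import Data.Bool using (Bool; true; false; _∧_; _∨_; not; if_then_else_; T)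
open import Data.Fin using (Fin; zero; suc)
open import Data.Product using (_×_; ∃-syntax)
open import Data.Sum using (_⊎_)
open import Relation.Nullary using (¬_)
open import Relation.Binary.PropositionalEquality using (_≡_)

count : ∀ {n} → (Fin n → Bool) → ℕ
count {zero}  p = 0
count {suc n} p = (if p zero then 1 else 0) + count (λ i → p (suc i))

anyFin : ∀ {n} → (Fin n → Bool) → Bool
anyFin {zero}  p = false
anyFin {suc n} p = p zero ∨ anyFin (λ i → p (suc i))

record SplitDigraph (n : ℕ) : Set where
  field
    arc : Fin n → Fin n → Bool
    inY : Fin n → Bool

module _ {n : ℕ} (D : SplitDigraph n) where
  open SplitDigraph D

  inX : Fin n → Bool
  inX v = not (inY v)

  IsOrientedSplitGraph : Set
  IsOrientedSplitGraph =
    (∀ u → ¬ T (arc u u))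
    × (∀ u v → T (arc u v) → ¬ T (arc v u))
    × (∀ u v → T (inX u) → T (inX v) → ¬ T (arc u v))
    × (∀ u v → T (inY u) → T (inY v) → ¬ (u ≡ v) → T (arc u v ∨ arc v u))

  out : Fin n → Fin n → Bool
  out u v = arc u v

  inn : Fin n → Fin n → Bool
  inn u v = arc v u

  d⁺ : Fin n → ℕ
  d⁺ u = count (out u)

  d⁻ : Fin n → ℕ
  d⁻ u = count (inn u)

  d⁺Y : Fin n → ℕ
  d⁺Y u = count (λ v → inY v ∧ arc u v)

  d⁻Y : Fin n → ℕ
  d⁻Y u = count (λ v → inY v ∧ arc v u)

  YRegular : Set
  YRegular = ∀ y → T (inY y) → d⁺Y y ≡ d⁻Y y

  N⁺⁺ : Fin n → Fin n → Bool
  N⁺⁺ u v = anyFin (λ w → arc u w ∧ arc w v) ∧ not (arc u v)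

  N⁻⁻ : Fin n → Fin n → Bool
  N⁻⁻ u v = anyFin (λ w → arc v w ∧ arc w u) ∧ not (arc v u)

  d⁺⁺ : Fin n → ℕ
  d⁺⁺ u = count (N⁺⁺ u)

  d⁺⁺Y : Fin n → ℕ
  d⁺⁺Y u = count (λ v → N⁺⁺ u v ∧ inY v)

  d⁻⁻Y : Fin n → ℕ
  d⁻⁻Y u = count (λ v → N⁻⁻ u v ∧ inY v)

-- Let |Y| = 2k + 1, so in the regular tournament D[Y] every vertex has k out- and k
-- in-neighbours.  For x ∈ X put S = N⁺(x) ⊆ Y; then N⁺⁺(x) ∩ Y is the set R of vertices
-- of Y ∖ S hit by an arc from S.  The remaining vertices U of Y ∖ S beat all of S, so each
-- z ∈ U has k ≥ |S| + d⁺_U(z); summing over U and counting the arcs inside U gives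
-- 2k + 1 ≥ 2|S| + |U|, i.e. |R| ≥ |S| = d⁺(x), unless U = ∅, in which case
-- |R| = |Y| − d⁺(x) ≥ d⁻(x).  This is (A1); (A2) is (A1) for the reversed digraph, and
-- (B1), (B2) follow from (A1) and (A2) by comparing numbers.
-- For (C1), (C2): regularity makes every in-neighbour of y ∈ Y inside Y a second
-- out-neighbour of y.  If d⁺⁺(v) < d⁺(v) for every vertex v, each y ∈ Y thus has fewer
-- second out-neighbours than out-neighbours in X, while (A1), (A2) give d⁻(x) ≤ d⁻⁻_Y(x)
-- on X; double counting the arcs and 2-paths between X and Y turns this into
-- Σ_X d⁻ < Σ_X d⁻.  For d⁻ the same argument uses the arcs from X into Y instead.

{-# OPTIONS --safe #-}
module Submission where

open import Defs
open import Data.Bool using (Bool; true; false; _∧_; _∨_; not; if_then_else_; T)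
open import Data.Bool.Properties using (∧-assoc; ∧-comm; ∨-comm; T-∧; T-∨)
open import Data.Empty using (⊥-elim)
open import Data.Fin using (Fin; zero; suc; _≟_)
open import Data.Fin.Properties using (any?)
open import Data.Nat using (ℕ; zero; suc; _+_; _*_; _≤_; _<_; _≥_; z≤n; _≤?_; NonZero; ≢-nonZero)
open import Data.Nat.Tactic.RingSolver using (solve-∀)
open import Data.Nat.Properties
  using ( +-0-commutativeMonoid; ≤-refl; ≤-trans; ≤-antisym; <⇒≤; <⇒≢; <⇒≱; ≰⇒>; <-irrefl; ≤-<-trans; n<1+n
        ; +-comm; +-assoc; +-identityʳ; *-distribˡ-+; +-mono-≤; +-monoˡ-≤; +-mono-<; +-monoˡ-<; +-mono-<-≤; +-mono-≤-<
        ; +-cancelˡ-≤; +-cancelʳ-≤; +-cancelˡ-<; *-cancelˡ-≤; module ≤-Reasoning)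
open import Algebra.Properties.CommutativeMonoid.Sum +-0-commutativeMonoid
  using (sum; ∑-comm; ∑-distrib-+; sum-cong-≗)
open import Data.Product using (_×_; _,_; ∃; ∃-syntax; proj₁; proj₂)
open import Data.Sum using (_⊎_; inj₁; inj₂; fromInj₂)
import Data.Sum as Sum
import Data.Nat as ℕ
open import Data.Unit using (tt)
open import Function using (_∘_; _⇔_; Equivalence; mk⇔)
open import Relation.Binary.PropositionalEquality
  using (_≡_; refl; sym; trans; cong; cong₂; subst; module ≡-Reasoning)
open import Relation.Nullary using (¬_; yes; no; does; _×-dec_; contradiction)
open import Relation.Nullary.Decidable using (T?)

open Equivalence using (to; from)

T-not⁺ : ∀ {b} → ¬ T b → T (not b)
T-not⁺ {false} _ = tt
T-not⁺ {true} ¬t = ¬t tt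

T-not⁻ : ∀ {b} → T (not b) → ¬ T b
T-not⁻ {true} () _

T-∧⁺ : ∀ a {b} → T a → T b → T (a ∧ b)
T-∧⁺ a x y = from (T-∧ {a}) (x , y)

T-∧⁻ : ∀ a {b} → T (a ∧ b) → T a × T b
T-∧⁻ a = to (T-∧ {a})

_≡ᵇ_ : ∀ {n} → Fin n → Fin n → Bool
i ≡ᵇ j = does (i ≟ j)

≡ᵇ⇒≡ : ∀ {n} {i j : Fin n} → T (i ≡ᵇ j) → i ≡ j
≡ᵇ⇒≡ {i = i} {j} t with i ≟ j
... | yes i≡j = i≡j

≢⇒≢ᵇ : ∀ {n} {i j : Fin n} → ¬ i ≡ j → T (not (i ≡ᵇ j))
≢⇒≢ᵇ {i = i} {j} i≢j with i ≟ j
... | yes i≡j = i≢j i≡j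
... | no  _   = tt

≢ᵇ⇒≢ : ∀ {n} {i j : Fin n} → T (not (i ≡ᵇ j)) → ¬ i ≡ j
≢ᵇ⇒≢ {i = i} {j} t with i ≟ j
≢ᵇ⇒≢ () | yes _
... | no i≢j = i≢j

anyFin-intro : ∀ {n} (p : Fin n → Bool) i → T (p i) → T (anyFin p)
anyFin-intro p zero    pᵢ = from (T-∨ {p zero}) (inj₁ pᵢ)
anyFin-intro p (suc i) pᵢ = from (T-∨ {p zero}) (inj₂ (anyFin-intro (p ∘ suc) i pᵢ))

anyFin-cong : ∀ {n} {p q : Fin n → Bool} → (∀ i → p i ≡ q i) → anyFin p ≡ anyFin q
anyFin-cong {zero}  p≗q = refl
anyFin-cong {suc n} p≗q = cong₂ _∨_ (p≗q zero) (anyFin-cong (p≗q ∘ suc))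

-- Counting over Fin n

𝟙 : Bool → ℕ
𝟙 b = if b then 1 else 0

count≡sum : ∀ {n} (p : Fin n → Bool) → count p ≡ sum (𝟙 ∘ p)
count≡sum {zero} p = refl
count≡sum {suc n} p = cong (𝟙 (p zero) +_) (count≡sum (p ∘ suc))

sum-mono-≤ : ∀ {n} {f g : Fin n → ℕ} → (∀ i → f i ≤ g i) → sum f ≤ sum g
sum-mono-≤ {zero} f≤g = z≤n
sum-mono-≤ {suc n} f≤g = +-mono-≤ (f≤g zero) (sum-mono-≤ (f≤g ∘ suc))

sum-mono-< : ∀ {n} {f g : Fin n → ℕ} → (∀ i → f i ≤ g i) → ∀ j → f j < g j → sum f < sum g
sum-mono-< {suc n} f≤g zero    f<g = +-mono-<-≤ f<g (sum-mono-≤ (f≤g ∘ suc))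
sum-mono-< {suc n} f≤g (suc j) f<g = +-mono-≤-< (f≤g zero) (sum-mono-< (f≤g ∘ suc) j f<g)

count-mono : ∀ {n} {p q : Fin n → Bool} → (∀ i → T (p i) → T (q i)) → count p ≤ count q
count-mono {p = p} {q} p⊆q = begin
  count p       ≡⟨ count≡sum p ⟩
  sum (𝟙 ∘ p)   ≤⟨ sum-mono-≤ (λ i → 𝟙-mono (p⊆q i)) ⟩
  sum (𝟙 ∘ q)   ≡⟨ count≡sum q ⟨
  count q       ∎
  where
  open ≤-Reasoning
  𝟙-mono : ∀ {a b} → (T a → T b) → 𝟙 a ≤ 𝟙 b
  𝟙-mono {false}         _   = z≤n
  𝟙-mono {true} {true}   _   = ≤-refl
  𝟙-mono {true} {false} a⇒b = ⊥-elim (a⇒b tt)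

count-cong⇔ : ∀ {n} {p q : Fin n → Bool} → (∀ i → T (p i) ⇔ T (q i)) → count p ≡ count q
count-cong⇔ p⇔q = ≤-antisym (count-mono (to ∘ p⇔q)) (count-mono (from ∘ p⇔q))

count-cong : ∀ {n} {p q : Fin n → Bool} → (∀ i → p i ≡ q i) → count p ≡ count q
count-cong p≗q = count-cong⇔ λ i → mk⇔ (subst T (p≗q i)) (subst T (sym (p≗q i)))

count-false : ∀ n → count {n} (λ _ → false) ≡ 0
count-false zero    = refl
count-false (suc n) = count-false n

count-≡ᵇ : ∀ {n} (j : Fin n) → count (_≡ᵇ j) ≡ 1
count-≡ᵇ {suc n} zero    = cong suc (count-false n)
count-≡ᵇ {suc n} (suc j) = count-≡ᵇ j

count-split : ∀ {n} (q p : Fin n → Bool) →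
  count p ≡ count (λ i → q i ∧ p i) + count (λ i → not (q i) ∧ p i)
count-split q p = begin
  count p
    ≡⟨ count≡sum p ⟩
  sum (𝟙 ∘ p)
    ≡⟨ sum-cong-≗ (λ i → 𝟙-split (q i) (p i)) ⟩
  sum (λ i → 𝟙 (q i ∧ p i) + 𝟙 (not (q i) ∧ p i))
    ≡⟨ ∑-distrib-+ (λ i → 𝟙 (q i ∧ p i)) (λ i → 𝟙 (not (q i) ∧ p i)) ⟩
  sum (λ i → 𝟙 (q i ∧ p i)) + sum (λ i → 𝟙 (not (q i) ∧ p i))
    ≡⟨ cong₂ _+_ (count≡sum (λ i → q i ∧ p i)) (count≡sum (λ i → not (q i) ∧ p i)) ⟨
  count (λ i → q i ∧ p i) + count (λ i → not (q i) ∧ p i)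
    ∎
  where
  open ≡-Reasoning
  𝟙-split : ∀ a b → 𝟙 b ≡ 𝟙 (a ∧ b) + 𝟙 (not a ∧ b)
  𝟙-split true  b = sym (+-identityʳ (𝟙 b))
  𝟙-split false b = refl

count-disjoint-≤ : ∀ {n} {p q r : Fin n → Bool} →
  (∀ i → T (p i) → T (r i)) → (∀ i → T (q i) → T (r i)) → (∀ i → T (p i) → ¬ T (q i)) →
  count p + count q ≤ count r
count-disjoint-≤ {p = p} {q} {r} p⊆r q⊆r p∩q=∅ = begin
  count p + count q                                          ≤⟨ +-mono-≤ (count-mono p⊆p∩r) (count-mono q⊆r∖p) ⟩
  count (λ i → p i ∧ r i) + count (λ i → not (p i) ∧ r i)    ≡⟨ count-split p r ⟨
  count r                                                    ∎
  where
  open ≤-Reasoning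
  p⊆p∩r : ∀ i → T (p i) → T (p i ∧ r i)
  p⊆p∩r i pᵢ = T-∧⁺ (p i) pᵢ (p⊆r i pᵢ)
  q⊆r∖p : ∀ i → T (q i) → T (not (p i) ∧ r i)
  q⊆r∖p i qᵢ = T-∧⁺ (not (p i)) (T-not⁺ (λ pᵢ → p∩q=∅ i pᵢ qᵢ)) (q⊆r i qᵢ)

count-witness : ∀ {n} (p : Fin n → Bool) → 0 < count p → ∃ (T ∘ p)
count-witness {suc n} p pos with p zero in pzero
... | true  = zero , subst T (sym pzero) tt
... | false = let i , pᵢ = count-witness (p ∘ suc) pos in suc i , pᵢ

sumOver : ∀ {n} → (Fin n → Bool) → (Fin n → ℕ) → ℕ
sumOver p f = sum (λ i → if p i then f i else 0)

sumOver-const : ∀ {n} (p : Fin n → Bool) c → sumOver p (λ _ → c) ≡ count p * c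
sumOver-const {zero}  p c = refl
sumOver-const {suc n} p c with p zero
... | true  = cong (c +_) (sumOver-const (p ∘ suc) c)
... | false = sumOver-const (p ∘ suc) c

sumOver-cong : ∀ {n} (p : Fin n → Bool) {f g : Fin n → ℕ} →
  (∀ i → T (p i) → f i ≡ g i) → sumOver p f ≡ sumOver p g
sumOver-cong p f≡g = sum-cong-≗ λ i → if-cong (p i) (f≡g i)
  where
  if-cong : ∀ b {x y} → (T b → x ≡ y) → (if b then x else 0) ≡ (if b then y else 0)
  if-cong true  x≡y = x≡y tt
  if-cong false _   = refl

if-mono : ∀ b {x y} → (T b → x ≤ y) → (if b then x else 0) ≤ (if b then y else 0)
if-mono true  x≤y = x≤y tt
if-mono false _   = z≤n

sumOver-mono-≤ : ∀ {n} (p : Fin n → Bool) {f g : Fin n → ℕ} →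
  (∀ i → T (p i) → f i ≤ g i) → sumOver p f ≤ sumOver p g
sumOver-mono-≤ p f≤g = sum-mono-≤ λ i → if-mono (p i) (f≤g i)

sumOver-mono-< : ∀ {n} (p : Fin n → Bool) {f g : Fin n → ℕ} →
  (∀ i → T (p i) → f i < g i) → ∃ (T ∘ p) → sumOver p f < sumOver p g
sumOver-mono-< p f<g (j , pⱼ) =
  sum-mono-< (λ i → if-mono (p i) (<⇒≤ ∘ f<g i)) j (if-strict (p j) pⱼ (f<g j))
  where
  if-strict : ∀ b {x y} → T b → (T b → x < y) → (if b then x else 0) < (if b then y else 0)
  if-strict true _ x<y = x<y tt

sumOver-+ : ∀ {n} (p : Fin n → Bool) (f g : Fin n → ℕ) →
  sumOver p (λ i → f i + g i) ≡ sumOver p f + sumOver p g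
sumOver-+ p f g = begin
  sumOver p (λ i → f i + g i)
    ≡⟨ sum-cong-≗ (λ i → if-+ (p i)) ⟩
  sum (λ i → (if p i then f i else 0) + (if p i then g i else 0))
    ≡⟨ ∑-distrib-+ (λ i → if p i then f i else 0) (λ i → if p i then g i else 0) ⟩
  sumOver p f + sumOver p g
    ∎
  where
  open ≡-Reasoning
  if-+ : ∀ b {x y} → (if b then x + y else 0) ≡ (if b then x else 0) + (if b then y else 0)
  if-+ true  = refl
  if-+ false = refl

sumOver-count≡∑∑ : ∀ {n} (p : Fin n → Bool) (r : Fin n → Fin n → Bool) →
  sumOver p (λ u → count (r u)) ≡ sum (λ u → sum (λ v → 𝟙 (p u ∧ r u v)))
sumOver-count≡∑∑ {n} p r = sum-cong-≗ λ u → if-count (p u) (r u)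
  where
  if-count : ∀ b (q : Fin n → Bool) → (if b then count q else 0) ≡ sum (λ v → 𝟙 (b ∧ q v))
  if-count true  q = count≡sum q
  if-count false q = trans (sym (count-false n)) (count≡sum {n} (λ _ → false))

sumOver-count-comm : ∀ {n} (p q : Fin n → Bool) (R : Fin n → Fin n → Bool) →
  sumOver p (λ u → count (λ v → q v ∧ R u v)) ≡ sumOver q (λ v → count (λ u → p u ∧ R u v))
sumOver-count-comm p q R = begin
  sumOver p (λ u → count (λ v → q v ∧ R u v))
    ≡⟨ sumOver-count≡∑∑ p (λ u v → q v ∧ R u v) ⟩
  sum (λ u → sum (λ v → 𝟙 (p u ∧ (q v ∧ R u v))))
    ≡⟨ ∑-comm (λ u v → 𝟙 (p u ∧ (q v ∧ R u v))) ⟩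
  sum (λ v → sum (λ u → 𝟙 (p u ∧ (q v ∧ R u v))))
    ≡⟨ sum-cong-≗ (λ v → sum-cong-≗ λ u → cong 𝟙 (∧-exchange (p u) (q v) (R u v))) ⟩
  sum (λ v → sum (λ u → 𝟙 (q v ∧ (p u ∧ R u v))))
    ≡⟨ sumOver-count≡∑∑ q (λ v u → p u ∧ R u v) ⟨
  sumOver q (λ v → count (λ u → p u ∧ R u v))
    ∎
  where
  open ≡-Reasoning
  ∧-exchange : ∀ a b c → a ∧ (b ∧ c) ≡ b ∧ (a ∧ c)
  ∧-exchange true  b c = refl
  ∧-exchange false b c = sym (∧-comm b false)

-- Oriented split graphs

module OrientedSplitGraph {n} (D : SplitDigraph n) (osg : IsOrientedSplitGraph D) where
  open SplitDigraph D

  loopless : ∀ u → ¬ T (arc u u)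
  loopless = proj₁ osg

  antisymmetric : ∀ u v → T (arc u v) → ¬ T (arc v u)
  antisymmetric = proj₁ (proj₂ osg)

  X-independent : ∀ u v → T (inX D u) → T (inX D v) → ¬ T (arc u v)
  X-independent = proj₁ (proj₂ (proj₂ osg))

  Y-tournament : ∀ u v → T (inY u) → T (inY v) → ¬ u ≡ v → T (arc u v ∨ arc v u)
  Y-tournament = proj₂ (proj₂ (proj₂ osg))

  ∣Y∣ : ℕ
  ∣Y∣ = count inY

  arc-from-X : ∀ {u v} → T (inX D u) → T (arc u v) → T (inY v)
  arc-from-X {u} {v} u∈X uv with T? (inY v)
  ... | yes v∈Y = v∈Y
  ... | no  v∉Y = ⊥-elim (X-independent u v u∈X (T-not⁺ v∉Y) uv)

  arc-into-X : ∀ {u v} → T (inX D v) → T (arc u v) → T (inY u)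
  arc-into-X {u} {v} v∈X uv with T? (inY u)
  ... | yes u∈Y = u∈Y
  ... | no  u∉Y = ⊥-elim (X-independent u v (T-not⁺ u∉Y) v∈X uv)

  arc⇒Y-nonempty : ∀ {u v} → T (arc u v) → ∃ (T ∘ inY)
  arc⇒Y-nonempty {u} {v} uv with T? (inY u)
  ... | yes u∈Y = u , u∈Y
  ... | no  u∉Y = v , arc-from-X (T-not⁺ u∉Y) uv

  Y-adjacent : ∀ {u v} → T (inY u) → T (inY v) → ¬ u ≡ v → T (arc u v) ⊎ T (arc v u)
  Y-adjacent u∈Y v∈Y u≢v = to T-∨ (Y-tournament _ _ u∈Y v∈Y u≢v)

  arc⇒≢ : ∀ {u v} → T (arc u v) → ¬ u ≡ v
  arc⇒≢ {u} uv refl = loopless u uv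

  module _ (U : Fin n → Bool) (U⊆Y : ∀ v → T (U v) → T (inY v)) where

    out-neighbours⇔ : ∀ z w → T (arc z w ∧ (not (w ≡ᵇ z) ∧ U w)) ⇔ T (U w ∧ arc z w)
    out-neighbours⇔ z w = mk⇔
      (λ h → let zw , w∉z∈U = T-∧⁻ (arc z w) h in T-∧⁺ (U w) (proj₂ (T-∧⁻ (not (w ≡ᵇ z)) w∉z∈U)) zw)
      (λ h → let w∈U , zw = T-∧⁻ (U w) h in
             T-∧⁺ (arc z w) zw (T-∧⁺ (not (w ≡ᵇ z)) (≢⇒≢ᵇ (arc⇒≢ zw ∘ sym)) w∈U))

    in-neighbours⇔ : ∀ {z} → T (U z) → ∀ w → T (not (arc z w) ∧ (not (w ≡ᵇ z) ∧ U w)) ⇔ T (U w ∧ arc w z)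
    in-neighbours⇔ {z} z∈U w = mk⇔
      (λ h → let ¬zw , w∉z∈U = T-∧⁻ (not (arc z w)) h
                 w∉z , w∈U  = T-∧⁻ (not (w ≡ᵇ z)) w∉z∈U in
             T-∧⁺ (U w) w∈U (fromInj₂ (⊥-elim ∘ T-not⁻ ¬zw)
                                      (Y-adjacent (U⊆Y z z∈U) (U⊆Y w w∈U) (≢ᵇ⇒≢ w∉z ∘ sym))))
      (λ h → let w∈U , wz = T-∧⁻ (U w) h in
             T-∧⁺ (not (arc z w)) (T-not⁺ (antisymmetric w z wz)) (T-∧⁺ (not (w ≡ᵇ z)) (≢⇒≢ᵇ (arc⇒≢ wz)) w∈U))

    itself⇔ : ∀ {z} → T (U z) → ∀ w → T ((w ≡ᵇ z) ∧ U w) ⇔ T (w ≡ᵇ z)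
    itself⇔ {z} z∈U w = mk⇔ (proj₁ ∘ T-∧⁻ (w ≡ᵇ z)) λ w≡z → T-∧⁺ (w ≡ᵇ z) w≡z (subst (T ∘ U) (sym (≡ᵇ⇒≡ w≡z)) z∈U)

    tournament-degree-sum : ∀ {z} → T (U z) →
      count (λ w → U w ∧ arc z w) + count (λ w → U w ∧ arc w z) + 1 ≡ count U
    tournament-degree-sum {z} z∈U = begin
      count (λ w → U w ∧ arc z w) + count (λ w → U w ∧ arc w z) + 1
        ≡⟨ +-comm _ 1 ⟩
      1 + (count (λ w → U w ∧ arc z w) + count (λ w → U w ∧ arc w z))
        ≡⟨ cong₂ _+_ (trans (count-cong⇔ (itself⇔ z∈U)) (count-≡ᵇ z))
                     (cong₂ _+_ (count-cong⇔ (out-neighbours⇔ z)) (count-cong⇔ (in-neighbours⇔ z∈U))) ⟨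
      count (λ w → (w ≡ᵇ z) ∧ U w) + (count (λ w → arc z w ∧ U∖z w) + count (λ w → not (arc z w) ∧ U∖z w))
        ≡⟨ cong (count (λ w → (w ≡ᵇ z) ∧ U w) +_) (count-split (arc z) U∖z) ⟨
      count (λ w → (w ≡ᵇ z) ∧ U w) + count U∖z
        ≡⟨ count-split (_≡ᵇ z) U ⟨
      count U
        ∎
      where
      open ≡-Reasoning
      U∖z : Fin n → Bool
      U∖z w = not (w ≡ᵇ z) ∧ U w

    tournament-handshake :
      sumOver U (λ z → count (λ w → U w ∧ arc z w) + count (λ w → U w ∧ arc z w) + 1) ≡ count U * count U
    tournament-handshake = begin
      sumOver U (λ z → outU z + outU z + 1)
        ≡⟨ sumOver-+ U (λ z → outU z + outU z) (λ _ → 1) ⟩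
      sumOver U (λ z → outU z + outU z) + sumOver U (λ _ → 1)
        ≡⟨ cong (_+ sumOver U (λ _ → 1)) (sumOver-+ U outU outU) ⟩
      sumOver U outU + sumOver U outU + sumOver U (λ _ → 1)
        ≡⟨ cong (λ k → sumOver U outU + k + sumOver U (λ _ → 1)) (sumOver-count-comm U U arc) ⟩
      sumOver U outU + sumOver U inU + sumOver U (λ _ → 1)
        ≡⟨ cong (_+ sumOver U (λ _ → 1)) (sumOver-+ U outU inU) ⟨
      sumOver U (λ z → outU z + inU z) + sumOver U (λ _ → 1)
        ≡⟨ sumOver-+ U (λ z → outU z + inU z) (λ _ → 1) ⟨
      sumOver U (λ z → outU z + inU z + 1)
        ≡⟨ sumOver-cong U (λ z → tournament-degree-sum) ⟩
      sumOver U (λ _ → count U)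
        ≡⟨ sumOver-const U (count U) ⟩
      count U * count U
        ∎
      where
      open ≡-Reasoning
      outU inU : Fin n → ℕ
      outU z = count (λ w → U w ∧ arc z w)
      inU  z = count (λ w → U w ∧ arc w z)

  d⁺+d⁻≤∣Y∣ : ∀ {x} → T (inX D x) → d⁺ D x + d⁻ D x ≤ ∣Y∣
  d⁺+d⁻≤∣Y∣ {x} x∈X = count-disjoint-≤ (λ _ → arc-from-X x∈X) (λ _ → arc-into-X x∈X) (antisymmetric x)

  d⁺Y≡d⁺ : ∀ {x} → T (inX D x) → d⁺Y D x ≡ d⁺ D x
  d⁺Y≡d⁺ {x} x∈X = count-cong⇔ λ v →
    mk⇔ (proj₂ ∘ T-∧⁻ (inY v)) (λ xv → T-∧⁺ (inY v) (arc-from-X x∈X xv) xv)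

  d⁻Y≡d⁻ : ∀ {x} → T (inX D x) → d⁻Y D x ≡ d⁻ D x
  d⁻Y≡d⁻ {x} x∈X = count-cong⇔ λ v →
    mk⇔ (proj₂ ∘ T-∧⁻ (inY v)) (λ vx → T-∧⁺ (inY v) (arc-into-X x∈X vx) vx)

  d⁺X d⁻X d⁺⁺X : Fin n → ℕ
  d⁺X  v = count (λ w → inX D w ∧ arc v w)
  d⁻X  v = count (λ w → inX D w ∧ arc w v)
  d⁺⁺X v = count (λ w → inX D w ∧ N⁺⁺ D v w)

  d⁺-split : ∀ v → d⁺ D v ≡ d⁺Y D v + d⁺X v
  d⁺-split v = count-split inY (arc v)

  d⁻-split : ∀ v → d⁻ D v ≡ d⁻Y D v + d⁻X v
  d⁻-split v = count-split inY (λ w → arc w v)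

  d⁺⁺-split : ∀ v → d⁺⁺ D v ≡ count (λ w → inY w ∧ N⁺⁺ D v w) + d⁺⁺X v
  d⁺⁺-split v = count-split inY (N⁺⁺ D v)

  d⁺⁺Y≤d⁺⁺ : ∀ x → d⁺⁺Y D x ≤ d⁺⁺ D x
  d⁺⁺Y≤d⁺⁺ x = count-mono {p = λ v → N⁺⁺ D x v ∧ inY v} λ v → proj₁ ∘ T-∧⁻ (N⁺⁺ D x v)

  ∑Y-d⁺X≡∑X-d⁻ : sumOver inY d⁺X ≡ sumOver (inX D) (d⁻ D)
  ∑Y-d⁺X≡∑X-d⁻ = trans (sumOver-count-comm inY (inX D) arc) (sumOver-cong (inX D) λ _ → d⁻Y≡d⁻)

  ∑Y-d⁻X≡∑X-d⁺ : sumOver inY d⁻X ≡ sumOver (inX D) (d⁺ D)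
  ∑Y-d⁻X≡∑X-d⁺ = trans (sumOver-count-comm inY (inX D) (λ u v → arc v u)) (sumOver-cong (inX D) λ _ → d⁺Y≡d⁺)

  ∑Y-d⁺⁺X≡∑X-d⁻⁻Y : sumOver inY d⁺⁺X ≡ sumOver (inX D) (d⁻⁻Y D)
  ∑Y-d⁺⁺X≡∑X-d⁻⁻Y = trans (sumOver-count-comm inY (inX D) (N⁺⁺ D))
                          (sumOver-cong (inX D) λ x _ → count-cong λ v → ∧-comm (inY v) (N⁺⁺ D v x))

-- Oriented split graphs whose Y-part is a regular tournament

module RegularSplitGraph {n} (D : SplitDigraph n) (osg : IsOrientedSplitGraph D) (regular : YRegular D) where
  open SplitDigraph D
  open OrientedSplitGraph D osg

  d⁺Y+d⁺Y+1≡∣Y∣ : ∀ {y} → T (inY y) → d⁺Y D y + d⁺Y D y + 1 ≡ ∣Y∣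
  d⁺Y+d⁺Y+1≡∣Y∣ {y} y∈Y =
    trans (cong (λ k → d⁺Y D y + k + 1) (regular y y∈Y)) (tournament-degree-sum inY (λ _ v∈Y → v∈Y) y∈Y)

  d⁺Y-≮ : ∀ {y z} → T (inY y) → T (inY z) → ¬ d⁺Y D y < d⁺Y D z
  d⁺Y-≮ y∈Y z∈Y y<z =
    <⇒≢ (+-monoˡ-< 1 (+-mono-< y<z y<z)) (trans (d⁺Y+d⁺Y+1≡∣Y∣ y∈Y) (sym (d⁺Y+d⁺Y+1≡∣Y∣ z∈Y)))

  -- Without a 2-path y → w → v, the vertex v would beat y and every out-neighbour of y in Y.
  in-neighbour∈N⁺⁺ : ∀ {y v} → T (inY y) → T (inY v) → T (arc v y) → T (N⁺⁺ D y v)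
  in-neighbour∈N⁺⁺ {y} {v} y∈Y v∈Y vy with T? (anyFin (λ w → arc y w ∧ arc w v))
  ... | yes path   = T-∧⁺ (anyFin (λ w → arc y w ∧ arc w v)) path (T-not⁺ (antisymmetric v y vy))
  ... | no  ¬path = ⊥-elim (d⁺Y-≮ y∈Y v∈Y (begin-strict
        d⁺Y D y                       <⟨ n<1+n (d⁺Y D y) ⟩
        1 + d⁺Y D y                   ≡⟨ +-comm 1 (d⁺Y D y) ⟩
        d⁺Y D y + 1                   ≡⟨ cong (d⁺Y D y +_) (count-≡ᵇ y) ⟨
        d⁺Y D y + count (_≡ᵇ y)       ≤⟨ count-disjoint-≤ outY-y⊆outY-v y⊆outY-v y∉outY-y ⟩
        d⁺Y D v                       ∎))
    where
    open ≤-Reasoning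
    outY-y⊆outY-v : ∀ w → T (inY w ∧ arc y w) → T (inY w ∧ arc v w)
    outY-y⊆outY-v w h with w∈Y , yw ← T-∧⁻ (inY w) h
                      with Y-adjacent v∈Y w∈Y (λ { refl → antisymmetric y v yw vy })
    ... | inj₁ vw = T-∧⁺ (inY w) w∈Y vw
    ... | inj₂ wv = ⊥-elim (¬path (anyFin-intro (λ u → arc y u ∧ arc u v) w (T-∧⁺ (arc y w) yw wv)))
    y⊆outY-v : ∀ w → T (w ≡ᵇ y) → T (inY w ∧ arc v w)
    y⊆outY-v w w≡y = subst (λ u → T (inY u ∧ arc v u)) (sym (≡ᵇ⇒≡ w≡y)) (T-∧⁺ (inY y) y∈Y vy)
    y∉outY-y : ∀ w → T (inY w ∧ arc y w) → ¬ T (w ≡ᵇ y)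
    y∉outY-y w h w≡y = loopless y (subst (T ∘ arc y) (≡ᵇ⇒≡ w≡y) (proj₂ (T-∧⁻ (inY w) h)))

  d⁻Y+d⁺⁺X≤d⁺⁺ : ∀ {y} → T (inY y) → d⁻Y D y + d⁺⁺X y ≤ d⁺⁺ D y
  d⁻Y+d⁺⁺X≤d⁺⁺ {y} y∈Y = begin
    d⁻Y D y + d⁺⁺X y                              ≤⟨ +-monoˡ-≤ (d⁺⁺X y) (count-mono in⊆N⁺⁺) ⟩
    count (λ w → inY w ∧ N⁺⁺ D y w) + d⁺⁺X y      ≡⟨ d⁺⁺-split y ⟨
    d⁺⁺ D y                                       ∎
    where
    open ≤-Reasoning
    in⊆N⁺⁺ : ∀ w → T (inY w ∧ arc w y) → T (inY w ∧ N⁺⁺ D y w)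
    in⊆N⁺⁺ w h = let w∈Y , wy = T-∧⁻ (inY w) h in T-∧⁺ (inY w) w∈Y (in-neighbour∈N⁺⁺ y∈Y w∈Y wy)

  hit reached unreached : (Fin n → Bool) → Fin n → Bool
  hit       S v = anyFin (λ w → S w ∧ arc w v)
  reached   S v = hit S v ∧ (not (S v) ∧ inY v)
  unreached S v = not (hit S v) ∧ (not (S v) ∧ inY v)

  module _ (S : Fin n → Bool) (S⊆Y : ∀ v → T (S v) → T (inY v)) where

    ∣Y∣-partition : ∣Y∣ ≡ count S + count (reached S) + count (unreached S)
    ∣Y∣-partition = begin
      count inY
        ≡⟨ count-split S inY ⟩
      count (λ v → S v ∧ inY v) + count (λ v → not (S v) ∧ inY v)
        ≡⟨ cong₂ _+_ (count-cong⇔ S∩Y⇔S) (count-split (hit S) _) ⟩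
      count S + (count (reached S) + count (unreached S))
        ≡⟨ +-assoc (count S) _ _ ⟨
      count S + count (reached S) + count (unreached S)
        ∎
      where
      open ≡-Reasoning
      S∩Y⇔S : ∀ v → T (S v ∧ inY v) ⇔ T (S v)
      S∩Y⇔S v = mk⇔ (proj₁ ∘ T-∧⁻ (S v)) (λ v∈S → T-∧⁺ (S v) v∈S (S⊆Y v v∈S))

    unreached⇒ : ∀ {v} → T (unreached S v) → ¬ T (hit S v) × ¬ T (S v) × T (inY v)
    unreached⇒ {v} v∈U =
      let v∉hit , v∈Y∖S = T-∧⁻ (not (hit S v)) v∈U ; v∉S , v∈Y = T-∧⁻ (not (S v)) v∈Y∖S in
      T-not⁻ v∉hit , T-not⁻ v∉S , v∈Y

    unreached-beats-S : ∀ {z} → T (unreached S z) → count S + count (λ w → unreached S w ∧ arc z w) ≤ d⁺Y D z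
    unreached-beats-S {z} z∈U with z∉hit , z∉S , z∈Y ← unreached⇒ z∈U =
      count-disjoint-≤ S⊆out U⊆out S∩U=∅
      where
      S⊆out : ∀ w → T (S w) → T (inY w ∧ arc z w)
      S⊆out w w∈S with Y-adjacent z∈Y (S⊆Y w w∈S) (λ { refl → z∉S w∈S })
      ... | inj₁ zw = T-∧⁺ (inY w) (S⊆Y w w∈S) zw
      ... | inj₂ wz = ⊥-elim (z∉hit (anyFin-intro (λ u → S u ∧ arc u z) w (T-∧⁺ (S w) w∈S wz)))
      U⊆out : ∀ w → T (unreached S w ∧ arc z w) → T (inY w ∧ arc z w)
      U⊆out w h = let w∈U , zw = T-∧⁻ (unreached S w) h in T-∧⁺ (inY w) (proj₂ (proj₂ (unreached⇒ w∈U))) zw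
      S∩U=∅ : ∀ w → T (S w) → ¬ T (unreached S w ∧ arc z w)
      S∩U=∅ w w∈S h = proj₁ (proj₂ (unreached⇒ (proj₁ (T-∧⁻ (unreached S w) h)))) w∈S

    -- The u unreached vertices each beat all of S and span u(u − 1)/2 arcs among themselves,
    -- so summing 2 d⁺Y + 1 = |Y| over them gives u(2|S| + u) ≤ u|Y| = u(|S| + |reached S| + u).
    reached-≥-S : .{{NonZero (count (unreached S))}} → count S ≤ count (reached S)
    reached-≥-S = +-cancelˡ-≤ s s r (+-cancelʳ-≤ u (s + s) (s + r) (*-cancelˡ-≤ u (begin
      u * (s + s + u)
        ≡⟨ *-distribˡ-+ u (s + s) u ⟩
      u * (s + s) + u * u
        ≡⟨ cong₂ _+_ (sumOver-const (unreached S) (s + s)) handshake ⟨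
      sumOver (unreached S) (λ _ → s + s) + sumOver (unreached S) (λ z → outU z + outU z + 1)
        ≡⟨ sumOver-+ (unreached S) (λ _ → s + s) (λ z → outU z + outU z + 1) ⟨
      sumOver (unreached S) (λ z → s + s + (outU z + outU z + 1))
        ≤⟨ sumOver-mono-≤ (unreached S) (λ z → bounded) ⟩
      sumOver (unreached S) (λ _ → ∣Y∣)
        ≡⟨ sumOver-const (unreached S) ∣Y∣ ⟩
      u * ∣Y∣
        ≡⟨ cong (u *_) ∣Y∣-partition ⟩
      u * (s + r + u)
        ∎)))
      where
      open ≤-Reasoning
      s r u : ℕ
      s = count S
      r = count (reached S)
      u = count (unreached S)
      outU : Fin n → ℕ
      outU z = count (λ w → unreached S w ∧ arc z w)
      handshake : sumOver (unreached S) (λ z → outU z + outU z + 1) ≡ u * u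
      handshake = tournament-handshake (unreached S) (λ _ → proj₂ ∘ proj₂ ∘ unreached⇒)
      bounded : ∀ {z} → T (unreached S z) → s + s + (outU z + outU z + 1) ≤ ∣Y∣
      bounded {z} z∈U = begin
        s + s + (outU z + outU z + 1)         ≡⟨ +-interchange s (outU z) ⟩
        s + outU z + (s + outU z) + 1         ≤⟨ +-monoˡ-≤ 1 (+-mono-≤ (unreached-beats-S z∈U) (unreached-beats-S z∈U)) ⟩
        d⁺Y D z + d⁺Y D z + 1                 ≡⟨ d⁺Y+d⁺Y+1≡∣Y∣ (proj₂ (proj₂ (unreached⇒ z∈U))) ⟩
        ∣Y∣                                   ∎
        where
        +-interchange : ∀ a b → a + a + (b + b + 1) ≡ a + b + (a + b) + 1
        +-interchange = solve-∀

    reached-≥-S⊎no-unreached : count S ≤ count (reached S) ⊎ count (unreached S) ≡ 0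
    reached-≥-S⊎no-unreached with count (unreached S) ℕ.≟ 0
    ... | yes U=∅ = inj₂ U=∅
    ... | no  U≠∅ = inj₁ (reached-≥-S {{≢-nonZero U≠∅}})

  count-reached-out : ∀ {x} → count (reached (arc x)) ≡ d⁺⁺Y D x
  count-reached-out {x} = count-cong λ v → sym (∧-assoc (anyFin (λ w → arc x w ∧ arc w v)) (not (arc x v)) (inY v))

  d⁺⁺Y≥d⁺⊎d⁺⁺Y≥d⁻ : ∀ {x} → T (inX D x) → d⁺⁺Y D x ≥ d⁺ D x ⊎ d⁺⁺Y D x ≥ d⁻ D x
  d⁺⁺Y≥d⁺⊎d⁺⁺Y≥d⁻ {x} x∈X with reached-≥-S⊎no-unreached (arc x) (λ _ → arc-from-X x∈X)
  ... | inj₁ d⁺≤reached = inj₁ (subst (d⁺ D x ≤_) count-reached-out d⁺≤reached)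
  ... | inj₂ U=∅ = inj₂ (+-cancelˡ-≤ (d⁺ D x) _ _ (begin
    d⁺ D x + d⁻ D x
      ≤⟨ d⁺+d⁻≤∣Y∣ x∈X ⟩
    ∣Y∣
      ≡⟨ ∣Y∣-partition (arc x) (λ _ → arc-from-X x∈X) ⟩
    d⁺ D x + count (reached (arc x)) + count (unreached (arc x))
      ≡⟨ cong (d⁺ D x + count (reached (arc x)) +_) U=∅ ⟩
    d⁺ D x + count (reached (arc x)) + 0
      ≡⟨ +-identityʳ _ ⟩
    d⁺ D x + count (reached (arc x))
      ≡⟨ cong (d⁺ D x +_) count-reached-out ⟩
    d⁺ D x + d⁺⁺Y D x
      ∎))
    where open ≤-Reasoning

  d⁺≡d⁻Y+d⁺X : ∀ {y} → T (inY y) → d⁺ D y ≡ d⁻Y D y + d⁺X y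
  d⁺≡d⁻Y+d⁺X {y} y∈Y = trans (d⁺-split y) (cong (_+ d⁺X y) (regular y y∈Y))

  d⁺⁺-deficit-impossible : (f g h : Fin n → ℕ) →
    (∀ {y} → T (inY y) → f y ≡ d⁻Y D y + g y) → sumOver inY g ≡ sumOver (inX D) h →
    (∀ {x} → T (inX D x) → d⁺⁺Y D x < f x → h x ≤ d⁻⁻Y D x) →
    ∃ (T ∘ inY) → ¬ (∀ v → d⁺⁺ D v < f v)
  d⁺⁺-deficit-impossible f g h f≡d⁻Y+g ∑Y-g≡∑X-h bound Y≠∅ d⁺⁺<f = <-irrefl refl (begin-strict
    sumOver (inX D) h           ≤⟨ sumOver-mono-≤ (inX D) (λ x x∈X → bound x∈X (≤-<-trans (d⁺⁺Y≤d⁺⁺ x) (d⁺⁺<f x))) ⟩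
    sumOver (inX D) (d⁻⁻Y D)    ≡⟨ ∑Y-d⁺⁺X≡∑X-d⁻⁻Y ⟨
    sumOver inY d⁺⁺X            <⟨ sumOver-mono-< inY d⁺⁺X<g Y≠∅ ⟩
    sumOver inY g               ≡⟨ ∑Y-g≡∑X-h ⟩
    sumOver (inX D) h           ∎)
    where
    open ≤-Reasoning
    d⁺⁺X<g : ∀ y → T (inY y) → d⁺⁺X y < g y
    d⁺⁺X<g y y∈Y = +-cancelˡ-< (d⁻Y D y) _ _ (begin-strict
      d⁻Y D y + d⁺⁺X y    ≤⟨ d⁻Y+d⁺⁺X≤d⁺⁺ y∈Y ⟩
      d⁺⁺ D y             <⟨ d⁺⁺<f y ⟩
      f y                 ≡⟨ f≡d⁻Y+g y∈Y ⟩
      d⁻Y D y + g y       ∎)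

reverse : ∀ {n} → SplitDigraph n → SplitDigraph n
reverse D = record { arc = λ u v → SplitDigraph.arc D v u ; inY = SplitDigraph.inY D }

module _ {n} {D : SplitDigraph n} where
  open SplitDigraph D

  reverse-isOrientedSplitGraph : IsOrientedSplitGraph D → IsOrientedSplitGraph (reverse D)
  reverse-isOrientedSplitGraph (loopless , antisymmetric , X-independent , Y-tournament) =
      loopless
    , (λ u v → antisymmetric v u)
    , (λ u v u∈X v∈X → X-independent v u v∈X u∈X)
    , (λ u v u∈Y v∈Y u≢v → subst T (∨-comm (arc u v) (arc v u)) (Y-tournament u v u∈Y v∈Y u≢v))

  reverse-YRegular : YRegular D → YRegular (reverse D)
  reverse-YRegular regular y y∈Y = sym (regular y y∈Y)

  d⁺⁺Y-reverse : ∀ x → d⁺⁺Y (reverse D) x ≡ d⁻⁻Y D x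
  d⁺⁺Y-reverse x = count-cong λ v →
    cong (λ b → (b ∧ not (arc v x)) ∧ inY v) (anyFin-cong λ w → ∧-comm (arc w x) (arc v w))

dichotomies⇒≤ : ∀ {o i p q} → o ≤ p ⊎ i ≤ p → i ≤ q ⊎ o ≤ q → p < o → i ≤ q
dichotomies⇒≤ (inj₁ o≤p) _          p<o = contradiction o≤p (<⇒≱ p<o)
dichotomies⇒≤ (inj₂ i≤p) (inj₁ i≤q) _   = i≤q
dichotomies⇒≤ (inj₂ i≤p) (inj₂ o≤q) p<o = ≤-trans (≤-trans i≤p (<⇒≤ p<o)) o≤q

module SecondNeighbourhoodBounds {m} (D : SplitDigraph (suc m)) (osg : IsOrientedSplitGraph D) (regular : YRegular D) where
  open SplitDigraph D
  open OrientedSplitGraph D osg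
  open RegularSplitGraph D osg regular

  d⁻⁻Y≥d⁻⊎d⁻⁻Y≥d⁺ : ∀ {x} → T (inX D x) → d⁻⁻Y D x ≥ d⁻ D x ⊎ d⁻⁻Y D x ≥ d⁺ D x
  d⁻⁻Y≥d⁻⊎d⁻⁻Y≥d⁺ {x} x∈X = subst (λ k → k ≥ d⁻ D x ⊎ k ≥ d⁺ D x) (d⁺⁺Y-reverse {D = D} x)
    (RegularSplitGraph.d⁺⁺Y≥d⁺⊎d⁺⁺Y≥d⁻ (reverse D) (reverse-isOrientedSplitGraph osg) (reverse-YRegular {D = D} regular) x∈X)

  d⁺⁺Y<d⁺⇒d⁻≤d⁻⁻Y : ∀ {x} → T (inX D x) → d⁺⁺Y D x < d⁺ D x → d⁻ D x ≤ d⁻⁻Y D x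
  d⁺⁺Y<d⁺⇒d⁻≤d⁻⁻Y x∈X = dichotomies⇒≤ (d⁺⁺Y≥d⁺⊎d⁺⁺Y≥d⁻ x∈X) (d⁻⁻Y≥d⁻⊎d⁻⁻Y≥d⁺ x∈X)

  d⁺⁺Y<d⁻⇒d⁺≤d⁻⁻Y : ∀ {x} → T (inX D x) → d⁺⁺Y D x < d⁻ D x → d⁺ D x ≤ d⁻⁻Y D x
  d⁺⁺Y<d⁻⇒d⁺≤d⁻⁻Y x∈X = dichotomies⇒≤ (Sum.swap (d⁺⁺Y≥d⁺⊎d⁺⁺Y≥d⁻ x∈X)) (Sum.swap (d⁻⁻Y≥d⁻⊎d⁻⁻Y≥d⁺ x∈X))

  ∃d⁺⁺Y≥d⁺⊎∀d⁻⁻Y≥d⁻ : (∃[ x ] (T (inX D x) × d⁺⁺Y D x ≥ d⁺ D x)) ⊎ (∀ x → T (inX D x) → d⁻⁻Y D x ≥ d⁻ D x)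
  ∃d⁺⁺Y≥d⁺⊎∀d⁻⁻Y≥d⁻ with any? (λ x → T? (inX D x) ×-dec (d⁺ D x ≤? d⁺⁺Y D x))
  ... | yes found = inj₁ found
  ... | no  none  = inj₂ λ x x∈X → d⁺⁺Y<d⁺⇒d⁻≤d⁻⁻Y x∈X (≰⇒> λ d⁺≤ → none (x , x∈X , d⁺≤))

  ∃d⁺⁺Y≥d⁻⊎∀d⁻⁻Y≥d⁺ : (∃[ x ] (T (inX D x) × d⁺⁺Y D x ≥ d⁻ D x)) ⊎ (∀ x → T (inX D x) → d⁻⁻Y D x ≥ d⁺ D x)
  ∃d⁺⁺Y≥d⁻⊎∀d⁻⁻Y≥d⁺ with any? (λ x → T? (inX D x) ×-dec (d⁻ D x ≤? d⁺⁺Y D x))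
  ... | yes found = inj₁ found
  ... | no  none  = inj₂ λ x x∈X → d⁺⁺Y<d⁻⇒d⁺≤d⁻⁻Y x∈X (≰⇒> λ d⁻≤ → none (x , x∈X , d⁻≤))

  ∃d⁺⁺≥d⁺ : ∃[ v ] d⁺⁺ D v ≥ d⁺ D v
  ∃d⁺⁺≥d⁺ with any? (λ v → d⁺ D v ≤? d⁺⁺ D v)
  ... | yes found = found
  ... | no  none  =
    ⊥-elim (d⁺⁺-deficit-impossible (d⁺ D) d⁺X (d⁻ D) d⁺≡d⁻Y+d⁺X ∑Y-d⁺X≡∑X-d⁻ d⁺⁺Y<d⁺⇒d⁻≤d⁻⁻Y Y≠∅ d⁺⁺<d⁺)
    where
    d⁺⁺<d⁺ : ∀ v → d⁺⁺ D v < d⁺ D v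
    d⁺⁺<d⁺ v = ≰⇒> λ d⁺≤ → none (v , d⁺≤)
    Y≠∅ : ∃ (T ∘ inY)
    Y≠∅ = arc⇒Y-nonempty (proj₂ (count-witness (arc zero) (≤-<-trans z≤n (d⁺⁺<d⁺ zero))))

  ∃d⁺⁺≥d⁻ : ∃[ v ] d⁺⁺ D v ≥ d⁻ D v
  ∃d⁺⁺≥d⁻ with any? (λ v → d⁻ D v ≤? d⁺⁺ D v)
  ... | yes found = found
  ... | no  none  =
    ⊥-elim (d⁺⁺-deficit-impossible (d⁻ D) d⁻X (d⁺ D) (λ {y} _ → d⁻-split y) ∑Y-d⁻X≡∑X-d⁺ d⁺⁺Y<d⁻⇒d⁺≤d⁻⁻Y Y≠∅ d⁺⁺<d⁻)
    where
    d⁺⁺<d⁻ : ∀ v → d⁺⁺ D v < d⁻ D v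
    d⁺⁺<d⁻ v = ≰⇒> λ d⁻≤ → none (v , d⁻≤)
    Y≠∅ : ∃ (T ∘ inY)
    Y≠∅ = arc⇒Y-nonempty (proj₂ (count-witness (λ u → arc u zero) (≤-<-trans z≤n (d⁺⁺<d⁻ zero))))

theorem4p5 : (m : ℕ) (D : SplitDigraph (suc m))
    → IsOrientedSplitGraph D
    → YRegular D
    → ((∀ x → T (inX D x) → (d⁺⁺Y D x ≥ d⁺ D x) ⊎ (d⁺⁺Y D x ≥ d⁻ D x))
      × (∀ x → T (inX D x) → (d⁻⁻Y D x ≥ d⁻ D x) ⊎ (d⁻⁻Y D x ≥ d⁺ D x))
      × ((∃[ x' ] (T (inX D x') × d⁺⁺Y D x' ≥ d⁺ D x'))
         ⊎ (∀ x → T (inX D x) → d⁻⁻Y D x ≥ d⁻ D x))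
      × ((∃[ x' ] (T (inX D x') × d⁺⁺Y D x' ≥ d⁻ D x'))
         ⊎ (∀ x → T (inX D x) → d⁻⁻Y D x ≥ d⁺ D x))
      × (∃[ v ] d⁺⁺ D v ≥ d⁺ D v)
      × (∃[ v ] d⁺⁺ D v ≥ d⁻ D v))
theorem4p5 m D osg regular =
    (λ _ → d⁺⁺Y≥d⁺⊎d⁺⁺Y≥d⁻)
  , (λ _ → d⁻⁻Y≥d⁻⊎d⁻⁻Y≥d⁺)
  , ∃d⁺⁺Y≥d⁺⊎∀d⁻⁻Y≥d⁻
  , ∃d⁺⁺Y≥d⁻⊎∀d⁻⁻Y≥d⁺
  , ∃d⁺⁺≥d⁺
  , ∃d⁺⁺≥d⁻
  where
  open RegularSplitGraph D osg regular
  open SecondNeighbourhoodBounds D osg regular
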